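{- Let $c$, $k$ and $t$ be positive integers with $c\ge 2$ and $k\ge t+3$. Suppose $\mathcal{R}$ and $\mathcal{S}$ are cross $t$-intersecting subfamilies of $U^{[ck]}_{c,t+1}$ with $\tau_t(\mathcal{R})=\tau_t(\mathcal{S})=t+1$. If $\mathcal{R}$ is not $t$-intersecting, then one of the following holds: (i) $t=1$, and $\mathcal{R}=\{A_1,A_2,C\}$, $\mathcal{S}=\{B_1,B_2,C\}$ for some $A_1=\{e_1,e_2\}$, $A_2=\{e_3,e_4\}$, $B_1=\{e_1,e_3\}$, $B_2=\{e_2,e_4\}$, $C=\{e_1,e_4\}\in U^{[ck]}_{c,2}$; (ii) $|\mathcal{R}||\mathcal{S}|<(t+2)^2$ and $|\mathcal{R}|+|\mathcal{S}|\le 8$.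
   Context: $U^{[ck]}_{c,\ell}$ is the set of families of $\ell$ pairwise disjoint $c$-subsets ("blocks") of $[ck]$; members are sets of blocks and $A\cap B$ is the set of common blocks. A family is $t$-intersecting if any two of its members share at least $t$ blocks; two families are cross $t$-intersecting if any member of one and any member of the other share at least $t$ blocks. For $\mathcal{A}\subseteq U^{[ck]}_{c,\ell}$, $S\in U^{[ck]}_{c,s}$ is a $t$-cover of $\mathcal{A}$ if $|S\cap A|\ge t$ for all $A\in\mathcal{A}$, and $\tau_t(\mathcal{A})$ is the minimum such $s$. -}

module Defs where

open import Data.Nat using (ℕ; _*_; _+_)
open import Data.Bool using (Bool)
import Data.Bool.Properties as BoolP
open import Data.Fin.Subset using (Subset; ∣_∣; _∩_; Empty)
open import Data.Vec.Properties using (≡-dec)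
open import Data.List using (List; length; filter; [])
open import Data.List.Relation.Unary.All using (All)
open import Data.List.Relation.Unary.Any using (Any)
open import Data.List.Relation.Unary.AllPairs using (AllPairs)
open import Data.List.Relation.Binary.Subset.Propositional using (_⊆_)
open import Data.Product using (_×_; Σ)
open import Relation.Nullary using (¬_)
open import Relation.Binary.PropositionalEquality using (_≡_)
open import Relation.Binary.Definitions using (DecidableEquality)

Block : ℕ → Set
Block n = Subset n

block-≟ : ∀ {n} → DecidableEquality (Block n)
block-≟ = ≡-dec BoolP._≟_


Member : ℕ → Set
Member n = List (Block n)

InU : (n c ℓ : ℕ) → Member n → Set
InU n c ℓ A = (length A ≡ ℓ) × All (λ b → ∣ b ∣ ≡ c) A × AllPairs (λ x y → Empty (x ∩ y)) A

_≈_ : ∀ {n} → Member n → Member n → Set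
A ≈ B = (A ⊆ B) × (B ⊆ A)

∣_∩ᵐ_∣ : ∀ {n} → Member n → Member n → ℕ
∣_∩ᵐ_∣ {n} A B = length (filter (λ x → x ∈? B) A)
  where open import Data.List.Membership.DecPropositional (block-≟ {n}) using (_∈?_)

-- A family is a finite set of members, represented as a list of members
-- with no two entries equal as sets.
Family : ℕ → Set
Family n = List (Member n)

FamilyIn : (n c ℓ : ℕ) → Family n → Set
FamilyIn n c ℓ ℱ = All (InU n c ℓ) ℱ × AllPairs (λ A B → ¬ (A ≈ B)) ℱ

_∈ᶠ_ : ∀ {n} → Member n → Family n → Set
A ∈ᶠ ℱ = Any (λ B → A ≈ B) ℱ

∣_∣ᶠ : ∀ {n} → Family n → ℕ
∣ ℱ ∣ᶠ = length ℱ

_≈ᶠ_ : ∀ {n} → Family n → Family n → Set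
ℱ ≈ᶠ 𝒢 = ∀ A → (A ∈ᶠ ℱ → A ∈ᶠ 𝒢) × (A ∈ᶠ 𝒢 → A ∈ᶠ ℱ)

TIntersecting : ∀ {n} → ℕ → Family n → Set
TIntersecting t ℱ = ∀ A B → A ∈ᶠ ℱ → B ∈ᶠ ℱ → t Data.Nat.≤ ∣ A ∩ᵐ B ∣

CrossTIntersecting : ∀ {n} → ℕ → Family n → Family n → Set
CrossTIntersecting t ℱ 𝒢 = ∀ A B → A ∈ᶠ ℱ → B ∈ᶠ 𝒢 → t Data.Nat.≤ ∣ A ∩ᵐ B ∣

IsTCover : ∀ {n} → ℕ → Family n → Member n → Set
IsTCover t ℱ S = ∀ A → A ∈ᶠ ℱ → t Data.Nat.≤ ∣ S ∩ᵐ A ∣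

TauEq : (n c t : ℕ) → Family n → ℕ → Set
TauEq n c t ℱ m =
  Σ (Member n) (λ S → InU n c m S × IsTCover t ℱ S)
  × (∀ s (S : Member n) → InU n c s S → IsTCover t ℱ S → m Data.Nat.≤ s)

{-# OPTIONS --safe #-}

-- Write t = t' + 1, so that members consist of t' + 2 blocks. Take A₁, A₂ ∈ ℛ meeting in fewer
-- than t blocks. A member of 𝒮 meets each of them in at least t blocks, which forces
-- |A₁ ∩ A₂| = t' and confines it to A₁ ∪ A₂. With the core I = A₁ ∩ A₂ and the four letters
-- A₁ ∖ A₂ = {a, b}, A₂ ∖ A₁ = {c, d}, every member of 𝒮 is I together with one of a, b and one
-- of c, d. As τ_t(𝒮) = t + 1, no letter lies in all members of 𝒮 (I plus that letter would be a
-- t-cover), so 𝒮 contains two members with complementary letters, and squeezing each member of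
-- ℛ between them shows that it is I plus two letters as well. Members are now determined by
-- their letters, cross-intersection forbids a letter pair of 𝒮 from being the complement of one
-- of ℛ, and counting gives |ℛ| = 2 + x and |𝒮| = y with x + y ≤ 4. Hence |ℛ| + |𝒮| ≤ 6 and
-- |ℛ| |𝒮| ≤ 9, with equality only in the configuration of (i) (up to relabelling the letters),
-- which for t ≥ 2 is still below (t + 2)².

module Submission where

open import Defs
open import Data.Nat using (ℕ; _*_; _+_; _≤_; _<_)
open import Data.List using (List; []; _∷_)
open import Data.Product using (_×_; Σ)
open import Data.Sum using (_⊎_)
open import Relation.Nullary using (¬_)
open import Relation.Binary.PropositionalEquality using (_≡_)

open import Data.Nat using (zero; suc; _≤?_; s≤s; z≤n)
import Data.Nat as ℕ
open import Data.Nat.Properties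
  using (≮⇒≥; ≰⇒>; <⇒≤; ≤-reflexive; ≤-trans; ≤-antisym; ≤-pred; 1+n≰n; ≤ᵇ⇒≤; n≢0⇒n>0; m≤n+m;
         +-suc; +-comm; +-identityʳ; +-mono-≤; +-monoˡ-≤; +-monoʳ-≤; +-cancelˡ-≤; +-cancelʳ-≤; +-cancelˡ-≡;
         suc-injective; *-mono-≤; *-monoʳ-≤; module ≤-Reasoning)
open import Data.Nat.Solver using (module +-*-Solver)
open import Data.Bool using (Bool; true; false)
import Data.Bool as Bool
open import Data.Fin using (Fin; zero; suc; #_)
import Data.Fin.Properties as Finₚ
open import Data.Vec using (Vec; []; _∷_; tabulate)
import Data.Vec as Vec
import Data.Vec.Properties as Vecₚ
open import Data.Fin.Subset using (Subset; _∩_; ∁; Empty) renaming (∣_∣ to ∣_∣ˢ)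
open import Data.Fin.Subset.Properties
  using (anySubset?; ∩-idem; ∩-comm; ∩-inverseʳ; Empty-unique; ∣⊥∣≡0; ∪-∩-booleanAlgebra)
open import Algebra.Lattice.Properties.BooleanAlgebra (∪-∩-booleanAlgebra 4) using (¬-involutive)
open import Data.List using (length; lookup; filter; map; _++_)
open import Data.List.Properties
  using (length-filter; filter-all; filter-complete; filter-++; length-++; length-map; ≡-dec)
open import Data.List.Relation.Unary.All as All using (All; []; _∷_; all?)
open import Data.List.Relation.Unary.All.Properties using (¬All⇒Any¬; all-filter)
open import Data.List.Relation.Unary.Any as Any using (Any; here; there)
open import Data.List.Relation.Unary.Any.Properties using (lookup-index)
open import Data.List.Relation.Unary.AllPairs using (AllPairs; []; _∷_)
import Data.List.Relation.Unary.AllPairs.Properties as AllPairs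
open import Data.List.Relation.Unary.Unique.Propositional using (Unique)
import Data.List.Relation.Unary.Unique.Propositional.Properties as Unique
open import Data.List.Relation.Binary.Subset.Propositional using (_⊆_)
open import Data.List.Relation.Binary.Subset.Propositional.Properties using (⊆-refl; ⊆-trans)
open import Data.List.Relation.Binary.Disjoint.Propositional using (Disjoint)
open import Data.List.Membership.Propositional using (_∈_; _∉_; find; lose)
open import Data.List.Membership.Propositional.Properties
  using (∈-lookup; ∈-filter⁺; ∈-filter⁻; ∈-map⁺; ∈-map⁻; ∈-++⁺ˡ; ∈-++⁺ʳ; ∈-++⁻)
open import Data.Product using (_,_; proj₁; proj₂; ∃; ∃₂)
open import Data.Sum using (inj₁; inj₂; [_,_]′)
open import Data.Empty using (⊥-elim)
open import Function using (_∘_; _⇔_; mk⇔; Equivalence)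
open import Level using (0ℓ)
open import Relation.Nullary using (Dec; yes; no; does; contradiction; ¬?; _×-dec_; _⊎-dec_)
open import Relation.Nullary.Decidable using (True; toWitness; from-no; decidable-stable; dec-true; dec-false)
open import Relation.Unary using (Pred; Decidable)
open import Relation.Unary.Properties using (_∪?_; _∩?_; ∁?)
open import Relation.Binary.Definitions using (DecidableEquality)
open import Relation.Binary.PropositionalEquality
  using (refl; sym; trans; cong; cong₂; subst; subst₂; _≢_; module ≡-Reasoning)

module _ {A : Set} where

  Unique-lookup-injective : ∀ {xs : List A} → Unique xs → ∀ {i j} → lookup xs i ≡ lookup xs j → i ≡ j
  Unique-lookup-injective (x∉xs ∷ _) {zero}  {zero}  _  = refl
  Unique-lookup-injective (x∉xs ∷ _) {zero}  {suc j} eq = contradiction eq (All.lookup x∉xs (∈-lookup j))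
  Unique-lookup-injective (x∉xs ∷ _) {suc i} {zero}  eq = contradiction (sym eq) (All.lookup x∉xs (∈-lookup i))
  Unique-lookup-injective (_ ∷ xs!)  {suc i} {suc j} eq = cong suc (Unique-lookup-injective xs! eq)

  Unique-length-≤ : ∀ {xs ys : List A} → Unique xs → xs ⊆ ys → length xs ≤ length ys
  Unique-length-≤ {xs} {ys} xs! xs⊆ys = ≮⇒≥ λ ys<xs →
    let i , j , i<j , same-position = Finₚ.pigeonhole ys<xs position in
    Finₚ.<⇒≢ i<j (Unique-lookup-injective xs! (begin
      lookup xs i               ≡⟨ lookup-index (xs⊆ys (∈-lookup i)) ⟩
      lookup ys (position i)    ≡⟨ cong (lookup ys) same-position ⟩
      lookup ys (position j)    ≡⟨ lookup-index (xs⊆ys (∈-lookup j)) ⟨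
      lookup xs j               ∎))
    where
    open ≡-Reasoning
    position : Fin (length xs) → Fin (length ys)
    position i = Any.index (xs⊆ys (∈-lookup i))

  Unique-length-≡ : ∀ {xs ys : List A} → Unique xs → Unique ys → xs ⊆ ys → ys ⊆ xs → length xs ≡ length ys
  Unique-length-≡ xs! ys! xs⊆ys ys⊆xs = ≤-antisym (Unique-length-≤ xs! xs⊆ys) (Unique-length-≤ ys! ys⊆xs)

  length≡0⇒[] : ∀ {xs : List A} → length xs ≡ 0 → xs ≡ []
  length≡0⇒[] {[]} refl = refl

  length≡1⇒singleton : ∀ {xs : List A} → length xs ≡ 1 → ∃ λ x → xs ≡ x ∷ []
  length≡1⇒singleton {x ∷ []} refl = x , refl

  length≡2⇒pair : ∀ {xs : List A} → length xs ≡ 2 → ∃₂ λ x y → xs ≡ x ∷ y ∷ []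
  length≡2⇒pair {x ∷ y ∷ []} refl = x , y , refl

  AllPairs-weaken : ∀ {R S : A → A → Set} {xs} → (∀ {x y} → x ∈ xs → y ∈ xs → R x y → S x y) →
                    AllPairs R xs → AllPairs S xs
  AllPairs-weaken R⇒S []         = []
  AllPairs-weaken R⇒S (Rx ∷ Rxs) = All.tabulate (λ y∈ → R⇒S (here refl) (there y∈) (All.lookup Rx y∈)) ∷
                                   AllPairs-weaken (λ x∈ y∈ → R⇒S (there x∈) (there y∈)) Rxs

  infix 4 _≋_
  _≋_ : List A → List A → Set
  xs ≋ ys = xs ⊆ ys × ys ⊆ xs

  ≋-trans : ∀ {xs ys zs : List A} → xs ≋ ys → ys ≋ zs → xs ≋ zs
  ≋-trans (xs⊆ys , ys⊆xs) (ys⊆zs , zs⊆ys) = ys⊆zs ∘ xs⊆ys , ys⊆xs ∘ zs⊆ys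

  length-filter-+-∁ : ∀ {P : Pred A 0ℓ} (P? : Decidable P) xs →
                      length (filter P? xs) + length (filter (∁? P?) xs) ≡ length xs
  length-filter-+-∁ P? [] = refl
  length-filter-+-∁ P? (x ∷ xs) with P? x
  ... | yes _ = cong suc (length-filter-+-∁ P? xs)
  ... | no  _ = trans (+-suc _ _) (cong suc (length-filter-+-∁ P? xs))

  module _ {P Q : Pred A 0ℓ} (P? : Decidable P) (Q? : Decidable Q) where

    length-filter-∪-∩ : ∀ xs → length (filter P? xs) + length (filter Q? xs)
                              ≡ length (filter (P? ∪? Q?) xs) + length (filter (P? ∩? Q?) xs)
    length-filter-∪-∩ [] = refl
    length-filter-∪-∩ (x ∷ xs) with does (P? x) | does (Q? x)
    ... | true  | true  =
      cong suc (trans (+-suc _ _) (trans (cong suc (length-filter-∪-∩ xs)) (sym (+-suc _ _))))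
    ... | true  | false = cong suc (length-filter-∪-∩ xs)
    ... | false | true  = trans (+-suc _ _) (cong suc (length-filter-∪-∩ xs))
    ... | false | false = length-filter-∪-∩ xs

    length-filter-×-dec : ∀ xs → length (filter (λ x → P? x ×-dec Q? x) xs)
                                ≡ ∣ tabulate (does ∘ P? ∘ lookup xs) ∩ tabulate (does ∘ Q? ∘ lookup xs) ∣ˢ
    length-filter-×-dec []       = refl
    length-filter-×-dec (x ∷ xs) with does (P? x) | does (Q? x)
    ... | true  | true  = cong suc (length-filter-×-dec xs)
    ... | true  | false = length-filter-×-dec xs
    ... | false | true  = length-filter-×-dec xs
    ... | false | false = length-filter-×-dec xs

    length-filter-cong : ∀ {xs} → (∀ {x} → x ∈ xs → P x ⇔ Q x) → length (filter P? xs) ≡ length (filter Q? xs)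
    length-filter-cong {[]}     _   = refl
    length-filter-cong {x ∷ xs} P⇔Q with P? x | Q? x
    ... | yes _  | yes _  = cong suc (length-filter-cong (P⇔Q ∘ there))
    ... | no  _  | no  _  = length-filter-cong (P⇔Q ∘ there)
    ... | yes px | no ¬qx = contradiction (Equivalence.to (P⇔Q (here refl)) px) ¬qx
    ... | no ¬px | yes qx = contradiction (Equivalence.from (P⇔Q (here refl)) qx) ¬px

module WithDecidableEquality {A : Set} (_≟_ : DecidableEquality A) where

  open import Data.List.Membership.DecPropositional _≟_ using (_∈?_)

  Unique-⊆-length⇒⊇ : ∀ {xs ys : List A} → Unique xs → xs ⊆ ys → length ys ≤ length xs → ys ⊆ xs
  Unique-⊆-length⇒⊇ {xs} {ys} xs! xs⊆ys ys≤xs {y} y∈ys with y ∈? xs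
  ... | yes y∈xs = y∈xs
  ... | no  y∉xs = contradiction (≤-trans (Unique-length-≤ y∷xs! y∷xs⊆ys) ys≤xs) 1+n≰n
    where
    y∷xs! : Unique (y ∷ xs)
    y∷xs! = All.tabulate (λ x∈xs y≡x → y∉xs (subst (_∈ xs) (sym y≡x) x∈xs)) ∷ xs!
    y∷xs⊆ys : y ∷ xs ⊆ ys
    y∷xs⊆ys (here refl)  = y∈ys
    y∷xs⊆ys (there x∈xs) = xs⊆ys x∈xs

  length-filter-superset : ∀ {P : Pred A 0ℓ} (P? : Decidable P) {X W : List A} → Unique X → Unique W → X ⊆ W →
                           length (filter P? X) ≡ length (filter (λ w → w ∈? X ×-dec P? w) W)
  length-filter-superset {P} P? {X} {W} X! W! X⊆W =
    Unique-length-≡ (Unique.filter⁺ P? X!) (Unique.filter⁺ X∩P? {W} W!)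
      (λ x∈ → let x∈X , Px = ∈-filter⁻ P? x∈ in ∈-filter⁺ X∩P? (X⊆W x∈X) (x∈X , Px))
      (λ x∈ → let _ , x∈X , Px = ∈-filter⁻ X∩P? {xs = W} x∈ in ∈-filter⁺ P? x∈X Px)
    where
    X∩P? : Decidable (λ w → w ∈ X × P w)
    X∩P? w = w ∈? X ×-dec P? w

double-suc : ∀ s → suc s + suc s ≡ (2 + s) + s
double-suc s = cong suc (+-suc s s)

positive-sum-two : ∀ {x y} → 1 ≤ x → 1 ≤ y → x + y ≡ 2 → x ≡ 1 × y ≡ 1
positive-sum-two {1}           {1}           _ _ _ = refl , refl
positive-sum-two {1}           {suc (suc _)} _ _ ()
positive-sum-two {suc (suc x)} {suc y}       _ _ e =
  contradiction (trans (sym (+-suc x y)) (suc-injective (suc-injective e))) λ ()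

squeeze-arithmetic : ∀ {m c x y} → m ≤ c → suc c ≤ m + x → suc c ≤ m + y → m + (x + y) ≡ 2 + c →
                     m ≡ c × x ≡ 1 × y ≡ 1
squeeze-arithmetic {m} {c} {x} {y} m≤c c<m+x c<m+y m+x+y≡2+c = m≡c , positive-sum-two 1≤x 1≤y x+y≡2
  where
  open ≤-Reasoning
  open +-*-Solver using (solve; _:+_; _:=_)
  c≤m : c ≤ m
  c≤m = +-cancelˡ-≤ (2 + c) c m (begin
    (2 + c) + c         ≡⟨ double-suc c ⟨
    suc c + suc c       ≤⟨ +-mono-≤ c<m+x c<m+y ⟩
    (m + x) + (m + y)   ≡⟨ solve 3 (λ m x y → (m :+ x) :+ (m :+ y) := (m :+ (x :+ y)) :+ m) refl m x y ⟩
    (m + (x + y)) + m   ≡⟨ cong (_+ m) m+x+y≡2+c ⟩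
    (2 + c) + m         ∎)
  m≡c : m ≡ c
  m≡c = ≤-antisym m≤c c≤m
  1≤x : 1 ≤ x
  1≤x = +-cancelˡ-≤ c 1 x (begin c + 1 ≡⟨ +-comm c 1 ⟩ suc c ≤⟨ c<m+x ⟩ m + x ≡⟨ cong (_+ x) m≡c ⟩ c + x ∎)
  1≤y : 1 ≤ y
  1≤y = +-cancelˡ-≤ c 1 y (begin c + 1 ≡⟨ +-comm c 1 ⟩ suc c ≤⟨ c<m+y ⟩ m + y ≡⟨ cong (_+ y) m≡c ⟩ c + y ∎)
  x+y≡2 : x + y ≡ 2
  x+y≡2 = +-cancelˡ-≡ c (x + y) 2 (trans (cong (_+ (x + y)) (sym m≡c)) (trans m+x+y≡2+c (+-comm 2 c)))

product-bound : ∀ x y → x + y ≤ 4 → (2 + x) * y < 9 ⊎ (x ≡ 1 × y ≡ 3)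
product-bound 0 y y≤4                    = inj₁ (s≤s (*-monoʳ-≤ 2 y≤4))
product-bound 1 0 _                      = inj₁ (≤ᵇ⇒≤ 1 9 _)
product-bound 1 1 _                      = inj₁ (≤ᵇ⇒≤ 4 9 _)
product-bound 1 2 _                      = inj₁ (≤ᵇ⇒≤ 7 9 _)
product-bound 1 3 _                      = inj₂ (refl , refl)
product-bound 1 (suc (suc (suc (suc _)))) (s≤s (s≤s (s≤s (s≤s ()))))
product-bound 2 y (s≤s (s≤s y≤2))        = inj₁ (s≤s (*-monoʳ-≤ 4 y≤2))
product-bound 3 y (s≤s (s≤s (s≤s y≤1))) = inj₁ (s≤s (≤-trans (*-monoʳ-≤ 5 y≤1) (≤ᵇ⇒≤ 5 8 _)))
product-bound 4 0 _                      = inj₁ (s≤s z≤n)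
product-bound 4 (suc _) (s≤s (s≤s (s≤s (s≤s ()))))
product-bound (suc (suc (suc (suc (suc _))))) _ (s≤s (s≤s (s≤s (s≤s ()))))

9≤[t+2]² : ∀ t' → 9 ≤ (suc t' + 2) * (suc t' + 2)
9≤[t+2]² t' = *-mono-≤ 3≤t+2 3≤t+2
  where
  3≤t+2 : 3 ≤ suc t' + 2
  3≤t+2 = s≤s (m≤n+m 2 t')

10≤[t+2]² : ∀ {t'} → t' ≢ 0 → 10 ≤ (suc t' + 2) * (suc t' + 2)
10≤[t+2]² {t'} t'≢0 = ≤-trans (≤ᵇ⇒≤ 10 16 _) (*-mono-≤ 4≤t+2 4≤t+2)
  where
  4≤t+2 : 4 ≤ suc t' + 2
  4≤t+2 = s≤s (+-monoˡ-≤ 2 (n≢0⇒n>0 t'≢0))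

∣p∩∁p∣≡0 : ∀ {m} (p : Subset m) → ∣ p ∩ ∁ p ∣ˢ ≡ 0
∣p∩∁p∣≡0 {m} p = trans (cong ∣_∣ˢ (∩-inverseʳ p)) (∣⊥∣≡0 m)

∣p∣≡∣p∩q∣+∣p∩∁q∣ : ∀ {m} (p q : Subset m) → ∣ p ∣ˢ ≡ ∣ p ∩ q ∣ˢ + ∣ p ∩ ∁ q ∣ˢ
∣p∣≡∣p∩q∣+∣p∩∁q∣ []          []          = refl
∣p∣≡∣p∩q∣+∣p∩∁q∣ (true ∷ p)  (true ∷ q)  = cong suc (∣p∣≡∣p∩q∣+∣p∩∁q∣ p q)
∣p∣≡∣p∩q∣+∣p∩∁q∣ (true ∷ p)  (false ∷ q) = trans (cong suc (∣p∣≡∣p∩q∣+∣p∩∁q∣ p q)) (sym (+-suc _ _))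
∣p∣≡∣p∩q∣+∣p∩∁q∣ (false ∷ p) (_ ∷ q)     = ∣p∣≡∣p∩q∣+∣p∩∁q∣ p q

module _ {m : ℕ} where

  open import Data.List.Membership.DecPropositional (Finₚ._≟_ {m}) using (_∈?_)

  ⁅_,_⁆ : Fin m → Fin m → Subset m
  ⁅ i , j ⁆ = tabulate λ k → does (k ∈? (i ∷ j ∷ []))

  exceptionalᴿ exceptionalˢ : Fin m → Fin m → Fin m → Fin m → List (Subset m)
  exceptionalᴿ e₁ e₂ e₃ e₄ = ⁅ e₁ , e₂ ⁆ ∷ ⁅ e₃ , e₄ ⁆ ∷ ⁅ e₁ , e₄ ⁆ ∷ []
  exceptionalˢ e₁ e₂ e₃ e₄ = ⁅ e₁ , e₃ ⁆ ∷ ⁅ e₂ , e₄ ⁆ ∷ ⁅ e₁ , e₄ ⁆ ∷ []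

module _ {n : ℕ} where

  open WithDecidableEquality (block-≟ {n})
  open import Data.List.Membership.DecPropositional (block-≟ {n}) using (_∈?_)

  ∩ᵐ-+-∩ᵐ-≤ : ∀ {X P Q : Member n} → Unique X →
            ∣ X ∩ᵐ P ∣ + ∣ X ∩ᵐ Q ∣ ≤ length (filter (λ x → x ∈? P ⊎-dec x ∈? Q) X) + ∣ P ∩ᵐ Q ∣
  ∩ᵐ-+-∩ᵐ-≤ {X} {P} {Q} X! = ≤-trans (≤-reflexive (length-filter-∪-∩ (_∈? P) (_∈? Q) X))
    (+-monoʳ-≤ _ (Unique-length-≤ (Unique.filter⁺ _ X!) λ x∈ →
      let x∈X , x∈P , x∈Q = ∈-filter⁻ (λ x → x ∈? P ×-dec x ∈? Q) {xs = X} x∈ in ∈-filter⁺ (_∈? Q) x∈P x∈Q))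

  module _ {X P Q : Member n} {s} (X! : Unique X) (∣X∣ : length X ≡ 2 + s)
           (P-large : suc s ≤ ∣ X ∩ᵐ P ∣) (Q-large : suc s ≤ ∣ X ∩ᵐ Q ∣) where

    private
      P∪Q? : Decidable (λ x → x ∈ P ⊎ x ∈ Q)
      P∪Q? x = x ∈? P ⊎-dec x ∈? Q

      lower-bound : (2 + s) + s ≤ length (filter P∪Q? X) + ∣ P ∩ᵐ Q ∣
      lower-bound = begin
        (2 + s) + s                 ≡⟨ double-suc s ⟨
        suc s + suc s               ≤⟨ +-mono-≤ P-large Q-large ⟩
        ∣ X ∩ᵐ P ∣ + ∣ X ∩ᵐ Q ∣      ≤⟨ ∩ᵐ-+-∩ᵐ-≤ X! ⟩
        length (filter P∪Q? X) + ∣ P ∩ᵐ Q ∣ ∎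
        where open ≤-Reasoning

    large-∩ᵐ⇒∩ᵐ-≥ : s ≤ ∣ P ∩ᵐ Q ∣
    large-∩ᵐ⇒∩ᵐ-≥ = +-cancelˡ-≤ (2 + s) s _
      (≤-trans lower-bound (+-monoˡ-≤ _ (≤-trans (length-filter P∪Q? X) (≤-reflexive ∣X∣))))

    large-∩ᵐ⇒⊆-∪ : ∣ P ∩ᵐ Q ∣ ≤ s → ∀ {x} → x ∈ X → x ∈ P ⊎ x ∈ Q
    large-∩ᵐ⇒⊆-∪ P∩Q≤s = All.lookup (subst (All _) (filter-complete P∪Q? ∣X∩[P∪Q]∣≡∣X∣) (all-filter P∪Q? X))
      where
      ∣X∣≤ : length X ≤ length (filter P∪Q? X)
      ∣X∣≤ = +-cancelʳ-≤ s (length X) _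
        (≤-trans (≤-reflexive (cong (_+ s) ∣X∣)) (≤-trans lower-bound (+-monoʳ-≤ _ P∩Q≤s)))
      ∣X∩[P∪Q]∣≡∣X∣ : length (filter P∪Q? X) ≡ length X
      ∣X∩[P∪Q]∣≡∣X∣ = ≤-antisym (length-filter P∪Q? X) ∣X∣≤

  _∖_ : Member n → Member n → Member n
  X ∖ Y = filter (∁? (_∈? Y)) X

  ∖-unique : ∀ {X} Y → Unique X → Unique (X ∖ Y)
  ∖-unique Y = Unique.filter⁺ (∁? (_∈? Y))

  ∈∖⁻ : ∀ {w} X Y → w ∈ X ∖ Y → w ∈ X × w ∉ Y
  ∈∖⁻ X Y = ∈-filter⁻ (∁? (_∈? Y)) {xs = X}

  length-∖ : ∀ {X Y : Member n} {s} → length X ≡ 2 + s → ∣ X ∩ᵐ Y ∣ ≡ s → length (X ∖ Y) ≡ 2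
  length-∖ {X} {Y} {s} ∣X∣ ∣X∩Y∣ = +-cancelˡ-≡ s _ 2
    (trans (cong (_+ length (X ∖ Y)) (sym ∣X∩Y∣)) (trans (length-filter-+-∁ (_∈? Y) X) (trans ∣X∣ (+-comm 2 s))))

  ∩ᵐ-mono : ∀ {M N A B : Member n} → Unique M → M ⊆ A → N ⊆ B → ∣ M ∩ᵐ N ∣ ≤ ∣ A ∩ᵐ B ∣
  ∩ᵐ-mono {M} {N} {A} {B} M! M⊆A N⊆B = Unique-length-≤ (Unique.filter⁺ (_∈? N) M!) λ x∈ →
    let x∈M , x∈N = ∈-filter⁻ (_∈? N) {xs = M} x∈ in ∈-filter⁺ (_∈? B) (M⊆A x∈M) (N⊆B x∈N)

  ∩ᵐ-comm : ∀ {X Y : Member n} → Unique X → Unique Y → ∣ X ∩ᵐ Y ∣ ≡ ∣ Y ∩ᵐ X ∣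
  ∩ᵐ-comm {X} {Y} X! Y! = Unique-length-≡ (Unique.filter⁺ (_∈? Y) X!) (Unique.filter⁺ (_∈? X) Y!)
    (λ x∈ → let x∈X , x∈Y = ∈-filter⁻ (_∈? Y) {xs = X} x∈ in ∈-filter⁺ (_∈? X) x∈Y x∈X)
    (λ x∈ → let x∈Y , x∈X = ∈-filter⁻ (_∈? X) {xs = Y} x∈ in ∈-filter⁺ (_∈? Y) x∈X x∈Y)

  ∩ᵐ-⊆ : ∀ {Y X : Member n} → Y ⊆ X → ∣ Y ∩ᵐ X ∣ ≡ length Y
  ∩ᵐ-⊆ {Y} {X} Y⊆X = cong length (filter-all (_∈? X) (All.tabulate Y⊆X))

  module _ {c : ℕ} (1≤c : 1 ≤ c) where

    disjoint-blocks-distinct : ∀ {x y : Block n} → ∣ x ∣ˢ ≡ c → Empty (x ∩ y) → x ≢ y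
    disjoint-blocks-distinct {x} ∣x∣ x∩y≡∅ refl = 1+n≰n (≤-trans 1≤c (≤-reflexive (trans (sym ∣x∣)
      (trans (cong ∣_∣ˢ (Empty-unique (subst Empty (∩-idem x) x∩y≡∅))) (∣⊥∣≡0 n)))))

    InU⇒Unique : ∀ {ℓ X} → InU n c ℓ X → Unique X
    InU⇒Unique (_ , sizes , disjoint) = go sizes disjoint
      where
      go : ∀ {X} → All (λ b → ∣ b ∣ˢ ≡ c) X → AllPairs (λ x y → Empty (x ∩ y)) X → Unique X
      go []             []         = []
      go (∣x∣ ∷ sizes) (x∩ ∷ x∩s) = All.map (disjoint-blocks-distinct ∣x∣) x∩ ∷ go sizes x∩s

  pairwise-disjoint-lookup : ∀ {X : Member n} {x y} → AllPairs (λ x y → Empty (x ∩ y)) X →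
                             x ∈ X → y ∈ X → x ≢ y → Empty (x ∩ y)
  pairwise-disjoint-lookup (x∩ ∷ _)  (here refl) (here refl) x≢y = contradiction refl x≢y
  pairwise-disjoint-lookup (x∩ ∷ _)  (here refl) (there y∈)  _   = All.lookup x∩ y∈
  pairwise-disjoint-lookup (y∩ ∷ _)  (there x∈)  (here refl) _   = subst Empty (∩-comm _ _) (All.lookup y∩ x∈)
  pairwise-disjoint-lookup (_ ∷ x∩s) (there x∈)  (there y∈)  x≢y = pairwise-disjoint-lookup x∩s x∈ y∈ x≢y

  InU-⊆ : ∀ {c ℓ X Y} → InU n c ℓ X → Unique Y → Y ⊆ X → InU n c (length Y) Y
  InU-⊆ {X = X} (_ , sizes , disjoint) Y! Y⊆X =
    refl , All.tabulate (All.lookup sizes ∘ Y⊆X) , go Y! (All.tabulate Y⊆X)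
    where
    go : ∀ {Y} → Unique Y → All (_∈ X) Y → AllPairs (λ x y → Empty (x ∩ y)) Y
    go []          []            = []
    go (x≢ ∷ Y!) (x∈X ∷ Y⊆X) =
      All.zipWith (λ (x≢y , y∈X) → pairwise-disjoint-lookup disjoint x∈X y∈X x≢y) (x≢ , Y⊆X) ∷ go Y! Y⊆X

  ≈-trans : ∀ {A B C : Member n} → A ≈ B → B ≈ C → A ≈ C
  ≈-trans (A⊆B , B⊆A) (B⊆C , C⊆B) = ⊆-trans A⊆B B⊆C , ⊆-trans C⊆B B⊆A

  ∈⇒∈ᶠ : ∀ {M : Member n} {F} → M ∈ F → M ∈ᶠ F
  ∈⇒∈ᶠ = Any.map λ { refl → ⊆-refl , ⊆-refl }

  non-intersecting-pair : ∀ {t} {F : Family n} → (∀ {A} → A ∈ F → Unique A) → ¬ TIntersecting t F →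
                          ∃₂ λ A₁ A₂ → A₁ ∈ F × A₂ ∈ F × ∣ A₁ ∩ᵐ A₂ ∣ < t
  non-intersecting-pair {t} {F} unique ¬intersecting
    with all? (λ A → all? (λ B → t ≤? ∣ A ∩ᵐ B ∣) F) F
  ... | yes all-pairs = contradiction intersecting ¬intersecting
    where
    intersecting : TIntersecting t F
    intersecting A B A∈ B∈ =
      let M , M∈F , A≈M = find A∈
          N , N∈F , B≈N = find B∈
      in ≤-trans (All.lookup (All.lookup all-pairs M∈F) N∈F) (∩ᵐ-mono (unique M∈F) (proj₂ A≈M) (proj₂ B≈N))
  ... | no ¬all-pairs =
    let A₁ , A₁∈F , ¬all₁ = find (¬All⇒Any¬ (λ A → all? (λ B → t ≤? ∣ A ∩ᵐ B ∣) F) F ¬all-pairs)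
        A₂ , A₂∈F , ¬t≤   = find (¬All⇒Any¬ (λ B → t ≤? ∣ A₁ ∩ᵐ B ∣) F ¬all₁)
    in A₁ , A₂ , A₁∈F , A₂∈F , ≰⇒> ¬t≤

  τ-nonempty : ∀ {c t} {F : Family n} → TauEq n c t F (suc t) → ∃ λ B → B ∈ F
  τ-nonempty {F = []}    (_ , minimal) = contradiction (minimal 0 [] (refl , [] , []) (λ _ ())) λ ()
  τ-nonempty {F = B ∷ _} _             = B , here refl

  τ-excludes-common-part : ∀ {c t} {F : Family n} {Y} → TauEq n c t F (suc t) → InU n c t Y →
                           ¬ (∀ {B} → B ∈ F → Y ⊆ B)
  τ-excludes-common-part {t = t} {F} {Y} (_ , minimal) Y∈U common = 1+n≰n (minimal t Y Y∈U cover)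
    where
    cover : IsTCover t F Y
    cover A A∈ = let M , M∈F , A≈M = find A∈ in
      ≤-reflexive (sym (trans (∩ᵐ-⊆ (⊆-trans (common M∈F) (proj₂ A≈M))) (proj₁ Y∈U)))

Exceptional : (n c : ℕ) → Family n → Family n → Set
Exceptional n c ℛ 𝒮 = Σ (Block n) λ e₁ → Σ (Block n) λ e₂ → Σ (Block n) λ e₃ → Σ (Block n) λ e₄ →
  InU n c 2 (e₁ ∷ e₂ ∷ []) × InU n c 2 (e₃ ∷ e₄ ∷ []) ×
  InU n c 2 (e₁ ∷ e₃ ∷ []) × InU n c 2 (e₂ ∷ e₄ ∷ []) ×
  InU n c 2 (e₁ ∷ e₄ ∷ []) ×
  (ℛ ≈ᶠ ((e₁ ∷ e₂ ∷ []) ∷ (e₃ ∷ e₄ ∷ []) ∷ (e₁ ∷ e₄ ∷ []) ∷ [])) ×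
  (𝒮 ≈ᶠ ((e₁ ∷ e₃ ∷ []) ∷ (e₂ ∷ e₄ ∷ []) ∷ (e₁ ∷ e₄ ∷ []) ∷ []))

record IsFrame {n : ℕ} (core letters : Member n) : Set where
  field
    core-unique    : Unique core
    letters-unique : Unique letters
    core∩letters≡∅ : Disjoint core letters

module Frame {n : ℕ} {core letters : Member n} (isFrame : IsFrame core letters) where

  open IsFrame isFrame
  open WithDecidableEquality (block-≟ {n})
  open import Data.List.Membership.DecPropositional (block-≟ {n}) using (_∈?_)
  open import Data.List.Membership.DecPropositional (Finₚ._≟_ {length letters})
    using () renaming (_∈?_ to _∈ᶠ?_)

  letter : Fin (length letters) → Block n
  letter = lookup letters

  InFrame : Member n → Set
  InFrame X = Unique X × X ⊆ core ++ letters

  Spanned : Member n → Set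
  Spanned X = InFrame X × core ⊆ X

  profile : Member n → Subset (length letters)
  profile X = tabulate λ i → does (letter i ∈? X)

  frame-unique : Unique (core ++ letters)
  frame-unique = Unique.++⁺ core-unique letters-unique core∩letters≡∅

  ∩ᵐ-in-frame : ∀ {X Y} → InFrame X →
                ∣ X ∩ᵐ Y ∣ ≡ length (filter (λ w → w ∈? X ×-dec w ∈? Y) core) + ∣ profile X ∩ profile Y ∣ˢ
  ∩ᵐ-in-frame {X} {Y} (X! , X⊆frame) = begin
    ∣ X ∩ᵐ Y ∣
      ≡⟨ length-filter-superset (_∈? Y) X! frame-unique X⊆frame ⟩
    length (filter X∩Y? (core ++ letters))
      ≡⟨ cong length (filter-++ X∩Y? core letters) ⟩
    length (filter X∩Y? core ++ filter X∩Y? letters)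
      ≡⟨ length-++ (filter X∩Y? core) ⟩
    length (filter X∩Y? core) + length (filter X∩Y? letters)
      ≡⟨ cong (length (filter X∩Y? core) +_) (length-filter-×-dec (_∈? X) (_∈? Y) letters) ⟩
    length (filter X∩Y? core) + ∣ profile X ∩ profile Y ∣ˢ
      ∎
    where
    open ≡-Reasoning
    X∩Y? : Decidable (λ w → w ∈ X × w ∈ Y)
    X∩Y? w = w ∈? X ×-dec w ∈? Y

  ∩ᵐ-in-frame-⊇core : ∀ {X Y} → InFrame X → core ⊆ Y → ∣ X ∩ᵐ Y ∣ ≡ ∣ core ∩ᵐ X ∣ + ∣ profile X ∩ profile Y ∣ˢ
  ∩ᵐ-in-frame-⊇core {X} {Y} X∈F core⊆Y = trans (∩ᵐ-in-frame X∈F)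
    (cong (_+ ∣ profile X ∩ profile Y ∣ˢ)
      (length-filter-cong (λ w → w ∈? X ×-dec w ∈? Y) (_∈? X) {core} λ w∈core → mk⇔ proj₁ (_, core⊆Y w∈core)))

  length-in-frame : ∀ {X} → InFrame X → length X ≡ ∣ core ∩ᵐ X ∣ + ∣ profile X ∣ˢ
  length-in-frame {X} X∈F = begin
    length X                                                         ≡⟨ ∩ᵐ-⊆ {Y = X} ⊆-refl ⟨
    ∣ X ∩ᵐ X ∣                                                        ≡⟨ ∩ᵐ-in-frame X∈F ⟩
    length (filter (λ w → w ∈? X ×-dec w ∈? X) core) + ∣ profile X ∩ profile X ∣ˢ
        ≡⟨ cong₂ _+_ (length-filter-cong (λ w → w ∈? X ×-dec w ∈? X) (_∈? X) {core} λ _ → mk⇔ proj₁ λ w∈X → w∈X , w∈X)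
                     (cong ∣_∣ˢ (∩-idem (profile X))) ⟩
    ∣ core ∩ᵐ X ∣ + ∣ profile X ∣ˢ                                     ∎
    where open ≡-Reasoning

  ∩ᵐ-spanned : ∀ {X Y} → Spanned X → core ⊆ Y → ∣ X ∩ᵐ Y ∣ ≡ length core + ∣ profile X ∩ profile Y ∣ˢ
  ∩ᵐ-spanned {X} {Y} (X∈F , core⊆X) core⊆Y =
    trans (∩ᵐ-in-frame-⊇core X∈F core⊆Y) (cong (_+ ∣ profile X ∩ profile Y ∣ˢ) (∩ᵐ-⊆ core⊆X))

  profile-bit : ∀ X i → Vec.lookup (profile X) i ≡ does (letter i ∈? X)
  profile-bit X = Vecₚ.lookup∘tabulate _

  profile-≡⇒∈ : ∀ {X Y} → profile X ≡ profile Y → ∀ {i} → letter i ∈ X → letter i ∈ Y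
  profile-≡⇒∈ {X} {Y} pX≡pY {i} ℓ∈X with letter i ∈? Y in ℓ∈?Y
  ... | yes ℓ∈Y = ℓ∈Y
  ... | no  _   = contradiction (begin
    true                         ≡⟨ dec-true (letter i ∈? X) ℓ∈X ⟨
    does (letter i ∈? X)         ≡⟨ profile-bit X i ⟨
    Vec.lookup (profile X) i     ≡⟨ cong (λ p → Vec.lookup p i) pX≡pY ⟩
    Vec.lookup (profile Y) i     ≡⟨ profile-bit Y i ⟩
    does (letter i ∈? Y)         ≡⟨ cong does ℓ∈?Y ⟩
    false                        ∎) λ ()
    where open ≡-Reasoning

  spanned-⊆ : ∀ {X Y} → Spanned X → Spanned Y → profile X ≡ profile Y → X ⊆ Y
  spanned-⊆ {X} {Y} ((_ , X⊆frame) , _) (_ , core⊆Y) pX≡pY {w} w∈X with ∈-++⁻ core (X⊆frame w∈X)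
  ... | inj₁ w∈core    = core⊆Y w∈core
  ... | inj₂ w∈letters = subst (_∈ Y) (sym w≡ℓ) (profile-≡⇒∈ pX≡pY (subst (_∈ X) w≡ℓ w∈X))
    where
    w≡ℓ : w ≡ letter (Any.index w∈letters)
    w≡ℓ = lookup-index w∈letters

  profile-injective : ∀ {X Y} → Spanned X → Spanned Y → profile X ≡ profile Y → X ≈ Y
  profile-injective X∈F Y∈F pX≡pY = spanned-⊆ X∈F Y∈F pX≡pY , spanned-⊆ Y∈F X∈F (sym pX≡pY)

  ∩ᵐ-complementary : ∀ {P Q} → Spanned P → Spanned Q → profile Q ≡ ∁ (profile P) → ∣ P ∩ᵐ Q ∣ ≡ length core
  ∩ᵐ-complementary {P} {Q} P∈F (_ , core⊆Q) pQ≡∁pP = begin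
    ∣ P ∩ᵐ Q ∣                                    ≡⟨ ∩ᵐ-spanned P∈F core⊆Q ⟩
    length core + ∣ profile P ∩ profile Q ∣ˢ       ≡⟨ cong (λ q → length core + ∣ profile P ∩ q ∣ˢ) pQ≡∁pP ⟩
    length core + ∣ profile P ∩ ∁ (profile P) ∣ˢ   ≡⟨ cong (length core +_) (∣p∩∁p∣≡0 (profile P)) ⟩
    length core + 0                               ≡⟨ +-identityʳ _ ⟩
    length core                                   ∎
    where open ≡-Reasoning

  squeeze : ∀ {P Q X} → Spanned P → Spanned Q → profile Q ≡ ∁ (profile P) →
            Unique X → length X ≡ 2 + length core →
            suc (length core) ≤ ∣ X ∩ᵐ P ∣ → suc (length core) ≤ ∣ X ∩ᵐ Q ∣ →
            Spanned X × ∣ profile X ∩ profile P ∣ˢ ≡ 1 × ∣ profile X ∩ profile Q ∣ˢ ≡ 1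
  squeeze {P} {Q} {X} P∈F@((_ , P⊆frame) , core⊆P) Q∈F@((_ , Q⊆frame) , core⊆Q) pQ≡∁pP X! ∣X∣ P-large Q-large =
    (X∈F , core⊆X) , proj₁ (proj₂ tight) , trans (cong (λ q → ∣ profile X ∩ q ∣ˢ) pQ≡∁pP) (proj₂ (proj₂ tight))
    where
    X∈F : InFrame X
    X∈F = X! , [ P⊆frame , Q⊆frame ]′
                 ∘ large-∩ᵐ⇒⊆-∪ X! ∣X∣ P-large Q-large (≤-reflexive (∩ᵐ-complementary P∈F Q∈F pQ≡∁pP))
    m : ℕ
    m = ∣ core ∩ᵐ X ∣
    ∣X∣-split : m + (∣ profile X ∩ profile P ∣ˢ + ∣ profile X ∩ ∁ (profile P) ∣ˢ) ≡ 2 + length core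
    ∣X∣-split = begin
      m + (∣ profile X ∩ profile P ∣ˢ + ∣ profile X ∩ ∁ (profile P) ∣ˢ)
        ≡⟨ cong (m +_) (∣p∣≡∣p∩q∣+∣p∩∁q∣ (profile X) (profile P)) ⟨
      m + ∣ profile X ∣ˢ    ≡⟨ length-in-frame X∈F ⟨
      length X              ≡⟨ ∣X∣ ⟩
      2 + length core       ∎
      where open ≡-Reasoning
    tight : m ≡ length core × ∣ profile X ∩ profile P ∣ˢ ≡ 1 × ∣ profile X ∩ ∁ (profile P) ∣ˢ ≡ 1
    tight = squeeze-arithmetic {m} (length-filter (_∈? X) core)
      (≤-trans P-large (≤-reflexive (∩ᵐ-in-frame-⊇core X∈F core⊆P)))
      (≤-trans Q-large (≤-reflexive (trans (∩ᵐ-in-frame-⊇core X∈F core⊆Q)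
                                           (cong (λ q → m + ∣ profile X ∩ q ∣ˢ) pQ≡∁pP))))
      ∣X∣-split
    core⊆X : core ⊆ X
    core⊆X = All.lookup (subst (All (_∈ X)) (filter-complete (_∈? X) (proj₁ tight)) (all-filter (_∈? X) core))

  letter-injective : ∀ {i j} → letter i ≡ letter j → i ≡ j
  letter-injective = Unique-lookup-injective letters-unique

  letters-profile : ∀ (is : List (Fin (length letters))) →
                    profile (map letter is) ≡ tabulate λ k → does (k ∈ᶠ? is)
  letters-profile is = Vecₚ.tabulate-cong bit
    where
    bit : ∀ k → does (letter k ∈? map letter is) ≡ does (k ∈ᶠ? is)
    bit k with k ∈ᶠ? is
    ... | yes k∈is = dec-true (letter k ∈? map letter is) (∈-map⁺ letter k∈is)
    ... | no  k∉is = dec-false (letter k ∈? map letter is) λ ℓk∈ →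
      let l , l∈is , ℓk≡ℓl = ∈-map⁻ letter ℓk∈ in k∉is (subst (_∈ is) (sym (letter-injective ℓk≡ℓl)) l∈is)

  pair-profile : ∀ i j → profile (letter i ∷ letter j ∷ []) ≡ ⁅ i , j ⁆
  pair-profile i j = letters-profile (i ∷ j ∷ [])

  pair-spanned : core ≡ [] → ∀ {i j} → i ≢ j → Spanned (letter i ∷ letter j ∷ [])
  pair-spanned core≡[] {i} {j} i≢j =
    (((i≢j ∘ letter-injective) ∷ []) ∷ [] ∷ [] , ij⊆frame) , λ w∈core → contradiction (subst (_ ∈_) core≡[] w∈core) λ ()
    where
    ij⊆frame : letter i ∷ letter j ∷ [] ⊆ core ++ letters
    ij⊆frame (here refl)         = ∈-++⁺ʳ core (∈-lookup i)
    ij⊆frame (there (here refl)) = ∈-++⁺ʳ core (∈-lookup j)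

  ≈ᶠ-by-profiles : ∀ {𝒜 ℬ : Family n} → (∀ {A} → A ∈ 𝒜 → Spanned A) → (∀ {B} → B ∈ ℬ → Spanned B) →
                   map profile 𝒜 ≋ map profile ℬ → 𝒜 ≈ᶠ ℬ
  ≈ᶠ-by-profiles 𝒜-spanned ℬ-spanned (𝒜⊆ℬ , ℬ⊆𝒜) X =
    transfer 𝒜-spanned ℬ-spanned 𝒜⊆ℬ , transfer ℬ-spanned 𝒜-spanned ℬ⊆𝒜
    where
    transfer : ∀ {𝒜 ℬ : Family n} → (∀ {A} → A ∈ 𝒜 → Spanned A) → (∀ {B} → B ∈ ℬ → Spanned B) →
               map profile 𝒜 ⊆ map profile ℬ → X ∈ᶠ 𝒜 → X ∈ᶠ ℬ
    transfer 𝒜-spanned ℬ-spanned 𝒜⊆ℬ X∈𝒜 =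
      let A , A∈𝒜 , X≈A = find X∈𝒜
          B , B∈ℬ , pA≡pB = ∈-map⁻ profile (𝒜⊆ℬ (∈-map⁺ profile A∈𝒜))
      in lose B∈ℬ (≈-trans X≈A (profile-injective (𝒜-spanned A∈𝒜) (ℬ-spanned B∈ℬ) pA≡pB))

  InU-by-profile : ∀ {c ℓ 𝒜 Y} → (∀ {A} → A ∈ 𝒜 → InU n c ℓ A × Spanned A) → Spanned Y →
                   profile Y ∈ map profile 𝒜 → InU n c (length Y) Y
  InU-by-profile 𝒜-ok Y-spanned pY∈ =
    let A , A∈𝒜 , pY≡pA = ∈-map⁻ profile pY∈
        A∈U , A-spanned = 𝒜-ok A∈𝒜
    in InU-⊆ A∈U (proj₁ (proj₁ Y-spanned)) (spanned-⊆ Y-spanned A-spanned pY≡pA)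

  letter-avoided : ∀ {c S A ℓ} → TauEq n c (suc (length core)) S (2 + length core) →
                   (∀ {B} → B ∈ S → core ⊆ B) → InU n c ℓ A → core ⊆ A →
                   ∀ {i} → letter i ∈ A → ∃ λ B → B ∈ S × letter i ∉ B
  letter-avoided {c} {S} τ≡ core⊆S A∈U core⊆A {i} ℓ∈A with all? (letter i ∈?_) S
  ... | yes ℓ∈S = ⊥-elim (τ-excludes-common-part τ≡ ℓ∷core∈U common)
    where
    ℓ∷core⊆ : ∀ {B} → letter i ∈ B → core ⊆ B → letter i ∷ core ⊆ B
    ℓ∷core⊆ ℓ∈B core⊆B (here refl) = ℓ∈B
    ℓ∷core⊆ ℓ∈B core⊆B (there w∈core) = core⊆B w∈core
    common : ∀ {B} → B ∈ S → letter i ∷ core ⊆ B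
    common B∈S = ℓ∷core⊆ (All.lookup ℓ∈S B∈S) (core⊆S B∈S)
    ℓ∷core! : Unique (letter i ∷ core)
    ℓ∷core! = All.tabulate (λ w∈core ℓ≡w → core∩letters≡∅ (subst (_∈ core) (sym ℓ≡w) w∈core , ∈-lookup i)) ∷ core-unique
    ℓ∷core∈U : InU n c (suc (length core)) (letter i ∷ core)
    ℓ∷core∈U = InU-⊆ A∈U ℓ∷core! (ℓ∷core⊆ ℓ∈A core⊆A)
  ... | no ℓ∉S = find (¬All⇒Any¬ (letter i ∈?_) S ℓ∉S)

  exceptional-by-profiles : ∀ {c ℛ 𝒮} → core ≡ [] →
    (∀ {A} → A ∈ ℛ → InU n c 2 A × Spanned A) → (∀ {B} → B ∈ 𝒮 → InU n c 2 B × Spanned B) →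
    ∀ {e₁ e₂ e₃ e₄} → Unique (e₁ ∷ e₂ ∷ e₃ ∷ e₄ ∷ []) →
    map profile ℛ ≋ exceptionalᴿ e₁ e₂ e₃ e₄ → map profile 𝒮 ≋ exceptionalˢ e₁ e₂ e₃ e₄ →
    Exceptional n c ℛ 𝒮
  exceptional-by-profiles {c} {ℛ} {𝒮} core≡[] ℛ-ok 𝒮-ok {e₁} {e₂} {e₃} {e₄}
    ((e₁≢e₂ ∷ e₁≢e₃ ∷ e₁≢e₄ ∷ []) ∷ (_ ∷ e₂≢e₄ ∷ []) ∷ (e₃≢e₄ ∷ []) ∷ [] ∷ []) ℛ≋ 𝒮≋ =
    letter e₁ , letter e₂ , letter e₃ , letter e₄ ,
    pair-InU ℛ-ok e₁≢e₂ (proj₂ ℛ≋ (here refl)) ,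
    pair-InU ℛ-ok e₃≢e₄ (proj₂ ℛ≋ (there (here refl))) ,
    pair-InU 𝒮-ok e₁≢e₃ (proj₂ 𝒮≋ (here refl)) ,
    pair-InU 𝒮-ok e₂≢e₄ (proj₂ 𝒮≋ (there (here refl))) ,
    pair-InU 𝒮-ok e₁≢e₄ (proj₂ 𝒮≋ (there (there (here refl)))) ,
    ≈ᶠ-by-profiles (proj₂ ∘ ℛ-ok) Ysᴿ-spanned (subst (map profile ℛ ≋_) (sym profilesᴿ) ℛ≋) ,
    ≈ᶠ-by-profiles (proj₂ ∘ 𝒮-ok) Ysˢ-spanned (subst (map profile 𝒮 ≋_) (sym profilesˢ) 𝒮≋)
    where
    pair : ∀ {i j} → i ≢ j → Spanned (letter i ∷ letter j ∷ [])
    pair = pair-spanned core≡[]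
    pair-InU : ∀ {𝒜 i j} → (∀ {A} → A ∈ 𝒜 → InU n c 2 A × Spanned A) → i ≢ j →
               ⁅ i , j ⁆ ∈ map profile 𝒜 → InU n c 2 (letter i ∷ letter j ∷ [])
    pair-InU {i = i} {j} 𝒜-ok i≢j ij∈𝒜 =
      InU-by-profile 𝒜-ok (pair i≢j) (subst (_∈ _) (sym (pair-profile i j)) ij∈𝒜)
    Ysᴿ Ysˢ : Family n
    Ysᴿ = (letter e₁ ∷ letter e₂ ∷ []) ∷ (letter e₃ ∷ letter e₄ ∷ []) ∷ (letter e₁ ∷ letter e₄ ∷ []) ∷ []
    Ysˢ = (letter e₁ ∷ letter e₃ ∷ []) ∷ (letter e₂ ∷ letter e₄ ∷ []) ∷ (letter e₁ ∷ letter e₄ ∷ []) ∷ []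
    profilesᴿ : map profile Ysᴿ ≡ exceptionalᴿ e₁ e₂ e₃ e₄
    profilesᴿ = cong₂ _∷_ (pair-profile e₁ e₂) (cong₂ _∷_ (pair-profile e₃ e₄) (cong (_∷ []) (pair-profile e₁ e₄)))
    profilesˢ : map profile Ysˢ ≡ exceptionalˢ e₁ e₂ e₃ e₄
    profilesˢ = cong₂ _∷_ (pair-profile e₁ e₃) (cong₂ _∷_ (pair-profile e₂ e₄) (cong (_∷ []) (pair-profile e₁ e₄)))
    Ysᴿ-spanned : ∀ {Y} → Y ∈ Ysᴿ → Spanned Y
    Ysᴿ-spanned (here refl)                 = pair e₁≢e₂
    Ysᴿ-spanned (there (here refl))         = pair e₃≢e₄
    Ysᴿ-spanned (there (there (here refl))) = pair e₁≢e₄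
    Ysˢ-spanned : ∀ {Y} → Y ∈ Ysˢ → Spanned Y
    Ysˢ-spanned (here refl)                 = pair e₁≢e₃
    Ysˢ-spanned (there (here refl))         = pair e₂≢e₄
    Ysˢ-spanned (there (there (here refl))) = pair e₁≢e₄

-- Profiles over four letters a, b, c, d; the transversals take one letter from each of {a, b} and {c, d}.
Profile : Set
Profile = Subset 4

profile-≟ : DecidableEquality Profile
profile-≟ = Vecₚ.≡-dec Bool._≟_

open import Data.List.Membership.DecPropositional profile-≟ using () renaming (_∈?_ to _∈ₚ?_)
open WithDecidableEquality profile-≟ using (Unique-⊆-length⇒⊇)
open import Data.List.Relation.Binary.Subset.DecPropositional profile-≟ using () renaming (_⊆?_ to _⊆ₚ?_)
open import Data.List.Relation.Unary.Unique.DecPropositional (Finₚ._≟_ {4}) using (unique?)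

AB AC AD BC BD CD : Profile
AB = true  ∷ true  ∷ false ∷ false ∷ []
AC = true  ∷ false ∷ true  ∷ false ∷ []
AD = true  ∷ false ∷ false ∷ true  ∷ []
BC = false ∷ true  ∷ true  ∷ false ∷ []
BD = false ∷ true  ∷ false ∷ true  ∷ []
CD = false ∷ false ∷ true  ∷ true  ∷ []

transversals : List Profile
transversals = AC ∷ AD ∷ BC ∷ BD ∷ []

pairs : List Profile
pairs = AB ∷ CD ∷ transversals

pattern ∈AC = here refl
pattern ∈AD = there (here refl)
pattern ∈BC = there (there (here refl))
pattern ∈BD = there (there (there (here refl)))

∣p∣≡2⇒p∈pairs : ∀ p → ∣ p ∣ˢ ≡ 2 → p ∈ pairs
∣p∣≡2⇒p∈pairs p ∣p∣≡2 = decidable-stable (p ∈ₚ? pairs) λ p∉pairs →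
  from-no (anySubset? λ q → (∣ q ∣ˢ ℕ.≟ 2) ×-dec ¬? (q ∈ₚ? pairs)) (p , ∣p∣≡2 , p∉pairs)

one-each⇒∈transversals : ∀ p → ∣ p ∩ AB ∣ˢ ≡ 1 → ∣ p ∩ CD ∣ˢ ≡ 1 → p ∈ transversals
one-each⇒∈transversals p ∣p∩AB∣ ∣p∩CD∣
  with ∣p∣≡2⇒p∈pairs p (trans (∣p∣≡∣p∩q∣+∣p∩∁q∣ p AB) (cong₂ _+_ ∣p∩AB∣ ∣p∩CD∣))
one-each⇒∈transversals p () _ | here refl
one-each⇒∈transversals p _ () | there (here refl)
... | there (there p∈transversals) = p∈transversals

∁-transversal : ∀ {p} → p ∈ transversals → ∁ p ∈ transversals
∁-transversal ∈AC = ∈BD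
∁-transversal ∈AD = ∈BC
∁-transversal ∈BC = ∈AD
∁-transversal ∈BD = ∈AC

∁-injective : ∀ {p q : Profile} → ∁ p ≡ ∁ q → p ≡ q
∁-injective {p} {q} ∁p≡∁q = trans (sym (¬-involutive p)) (trans (cong ∁ ∁p≡∁q) (¬-involutive q))

Avoids : (Profile → Set) → Fin 4 → Set
Avoids P i = ∃ λ p → p ∈ transversals × Vec.lookup p i ≡ false × P p

complementary-pair : ∀ {P} → Avoids P (# 0) → Avoids P (# 1) → Avoids P (# 2) → Avoids P (# 3) →
                     ∃ λ p → P p × P (∁ p)
complementary-pair (_ , ∈AC , () , _) _ _ _
complementary-pair (_ , ∈AD , () , _) _ _ _
complementary-pair _ (_ , ∈BC , () , _) _ _
complementary-pair _ (_ , ∈BD , () , _) _ _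
complementary-pair (_ , ∈BC , _ , bc) (_ , ∈AD , _ , ad) _ _ = AD , ad , bc
complementary-pair (_ , ∈BD , _ , bd) (_ , ∈AC , _ , ac) _ _ = AC , ac , bd
complementary-pair (_ , ∈BC , _ , bc) (_ , ∈AC , _ , _)  (_ , ∈AD , _ , ad) _ = AD , ad , bc
complementary-pair (_ , ∈BC , _ , _)  (_ , ∈AC , _ , ac) (_ , ∈BD , _ , bd) _ = AC , ac , bd
complementary-pair (_ , ∈BC , _ , _)  (_ , ∈AC , _ , _)  (_ , ∈AC , () , _) _
complementary-pair (_ , ∈BC , _ , _)  (_ , ∈AC , _ , _)  (_ , ∈BC , () , _) _
complementary-pair (_ , ∈BD , _ , bd) (_ , ∈AD , _ , _)  _ (_ , ∈AC , _ , ac) = AC , ac , bd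
complementary-pair (_ , ∈BD , _ , _)  (_ , ∈AD , _ , ad) _ (_ , ∈BC , _ , bc) = AD , ad , bc
complementary-pair (_ , ∈BD , _ , _)  (_ , ∈AD , _ , _)  _ (_ , ∈AD , () , _)
complementary-pair (_ , ∈BD , _ , _)  (_ , ∈AD , _ , _)  _ (_ , ∈BD , () , _)

infixl 6 _without_
_without_ : List Profile → Profile → List Profile
ps without r = filter (λ p → ¬? (profile-≟ p r)) ps

Extremal : List Profile → List Profile → Set
Extremal PR PS = ∃ λ q → q ∈ transversals × PR ≋ (AB ∷ CD ∷ q ∷ []) × PS ≋ (transversals without ∁ q)

-- The complements of the transversal profiles of PR avoid PS, and together with PS they fit
-- among the four transversals.
module _ {PR PS : List Profile} (PR-unique : Unique PR) (PS-unique : Unique PS)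
         (PR⊆pairs : PR ⊆ pairs) (PS⊆transversals : PS ⊆ transversals) (AB∈PR : AB ∈ PR) (CD∈PR : CD ∈ PR)
         (cross : ∀ {p q} → p ∈ PR → q ∈ PS → q ≢ ∁ p) where

  private
    PRᵗ : List Profile
    PRᵗ = filter (_∈ₚ? transversals) PR

    ∈PRᵗ⁻ : ∀ {p} → p ∈ PRᵗ → p ∈ PR × p ∈ transversals
    ∈PRᵗ⁻ = ∈-filter⁻ (_∈ₚ? transversals) {xs = PR}

    PR≋AB∷CD∷PRᵗ : PR ≋ (AB ∷ CD ∷ PRᵗ)
    PR≋AB∷CD∷PRᵗ = to , from
      where
      to : PR ⊆ AB ∷ CD ∷ PRᵗ
      to p∈PR with PR⊆pairs p∈PR
      ... | here refl             = here refl
      ... | there (here refl)     = there (here refl)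
      ... | there (there p∈T)     = there (there (∈-filter⁺ (_∈ₚ? transversals) p∈PR p∈T))
      from : AB ∷ CD ∷ PRᵗ ⊆ PR
      from (here refl)         = AB∈PR
      from (there (here refl)) = CD∈PR
      from (there (there p∈))  = proj₁ (∈PRᵗ⁻ p∈)

    PRᵗ-unique : Unique PRᵗ
    PRᵗ-unique = Unique.filter⁺ (_∈ₚ? transversals) PR-unique

    ∉transversals⇒∉PRᵗ : ∀ {r} → r ∉ transversals → All (r ≢_) PRᵗ
    ∉transversals⇒∉PRᵗ r∉ = All.tabulate λ p∈ r≡p → r∉ (subst (_∈ transversals) (sym r≡p) (proj₂ (∈PRᵗ⁻ p∈)))

    AB∷CD∷PRᵗ-unique : Unique (AB ∷ CD ∷ PRᵗ)
    AB∷CD∷PRᵗ-unique = ((λ ()) ∷ ∉transversals⇒∉PRᵗ (from-no (AB ∈ₚ? transversals)))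
                     ∷ ∉transversals⇒∉PRᵗ (from-no (CD ∈ₚ? transversals)) ∷ PRᵗ-unique

    length-PR : length PR ≡ 2 + length PRᵗ
    length-PR = Unique-length-≡ PR-unique AB∷CD∷PRᵗ-unique (proj₁ PR≋AB∷CD∷PRᵗ) (proj₂ PR≋AB∷CD∷PRᵗ)

    PS,∁PRᵗ : List Profile
    PS,∁PRᵗ = PS ++ map ∁ PRᵗ

    PS,∁PRᵗ-unique : Unique PS,∁PRᵗ
    PS,∁PRᵗ-unique = Unique.++⁺ PS-unique (Unique.map⁺ ∁-injective PRᵗ-unique)
      λ (q∈PS , q∈∁PRᵗ) → let p , p∈PRᵗ , q≡∁p = ∈-map⁻ ∁ q∈∁PRᵗ in
        cross (proj₁ (∈PRᵗ⁻ p∈PRᵗ)) q∈PS q≡∁p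

    PS,∁PRᵗ⊆transversals : PS,∁PRᵗ ⊆ transversals
    PS,∁PRᵗ⊆transversals q∈ with ∈-++⁻ PS q∈
    ... | inj₁ q∈PS    = PS⊆transversals q∈PS
    ... | inj₂ q∈∁PRᵗ = let p , p∈PRᵗ , q≡∁p = ∈-map⁻ ∁ q∈∁PRᵗ in
      subst (_∈ transversals) (sym q≡∁p) (∁-transversal (proj₂ (∈PRᵗ⁻ p∈PRᵗ)))

    length-PS,∁PRᵗ : length PS,∁PRᵗ ≡ length PS + length PRᵗ
    length-PS,∁PRᵗ = trans (length-++ PS) (cong (length PS +_) (length-map ∁ PRᵗ))

    PS+PRᵗ≤4 : length PS + length PRᵗ ≤ 4
    PS+PRᵗ≤4 = subst (_≤ 4) length-PS,∁PRᵗ (Unique-length-≤ PS,∁PRᵗ-unique PS,∁PRᵗ⊆transversals)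

    extremal : length PRᵗ ≡ 1 → length PS ≡ 3 → Extremal PR PS
    extremal ∣PRᵗ∣≡1 ∣PS∣≡3 = q , proj₂ (∈PRᵗ⁻ q∈PRᵗ) , PR≋AB∷CD∷q , PS⊆ , PS⊇
      where
      singleton : ∃ λ q → PRᵗ ≡ q ∷ []
      singleton = length≡1⇒singleton ∣PRᵗ∣≡1
      q : Profile
      q = proj₁ singleton
      PRᵗ≡q : PRᵗ ≡ q ∷ []
      PRᵗ≡q = proj₂ singleton
      q∈PRᵗ : q ∈ PRᵗ
      q∈PRᵗ = subst (q ∈_) (sym PRᵗ≡q) (here refl)
      q∈PR : q ∈ PR
      q∈PR = proj₁ (∈PRᵗ⁻ q∈PRᵗ)
      PR≋AB∷CD∷q : PR ≋ (AB ∷ CD ∷ q ∷ [])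
      PR≋AB∷CD∷q = subst (λ ps → PR ≋ (AB ∷ CD ∷ ps)) PRᵗ≡q PR≋AB∷CD∷PRᵗ
      PS⊆ : PS ⊆ transversals without ∁ q
      PS⊆ p∈PS = ∈-filter⁺ (λ p → ¬? (profile-≟ p (∁ q))) (PS⊆transversals p∈PS) (cross q∈PR p∈PS)
      transversals⊆PS,∁PRᵗ : transversals ⊆ PS,∁PRᵗ
      transversals⊆PS,∁PRᵗ = Unique-⊆-length⇒⊇ PS,∁PRᵗ-unique PS,∁PRᵗ⊆transversals
        (≤-reflexive (sym (trans length-PS,∁PRᵗ (cong₂ _+_ ∣PS∣≡3 ∣PRᵗ∣≡1))))
      PS⊇ : transversals without ∁ q ⊆ PS
      PS⊇ p∈ with ∈-filter⁻ (λ p → ¬? (profile-≟ p (∁ q))) {xs = transversals} p∈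
      ... | p∈transversals , p≢∁q with ∈-++⁻ PS (transversals⊆PS,∁PRᵗ p∈transversals)
      ...   | inj₁ p∈PS    = p∈PS
      ...   | inj₂ p∈∁PRᵗ with ∈-map⁻ ∁ p∈∁PRᵗ
      ...     | r , r∈PRᵗ , p≡∁r with subst (r ∈_) PRᵗ≡q r∈PRᵗ
      ...       | here refl = contradiction p≡∁r p≢∁q

    PRᵗ+PS≤4 : length PRᵗ + length PS ≤ 4
    PRᵗ+PS≤4 = subst (_≤ 4) (+-comm (length PS) (length PRᵗ)) PS+PRᵗ≤4

  profile-bounds : length PR + length PS ≤ 6 ×
                  (length PR * length PS < 9 ⊎ (length PR * length PS ≡ 9 × Extremal PR PS))
  profile-bounds rewrite length-PR with product-bound (length PRᵗ) (length PS) PRᵗ+PS≤4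
  ... | inj₁ small              = s≤s (s≤s PRᵗ+PS≤4) , inj₁ small
  ... | inj₂ (∣PRᵗ∣≡1 , ∣PS∣≡3) = s≤s (s≤s PRᵗ+PS≤4) ,
    inj₂ (cong₂ (λ x y → (2 + x) * y) ∣PRᵗ∣≡1 ∣PS∣≡3 , extremal ∣PRᵗ∣≡1 ∣PS∣≡3)

pairs-with : Profile → List Profile
pairs-with q = AB ∷ CD ∷ q ∷ []

-- The relabellings of a, b, c, d that put each extremal configuration into the shape of (i);
-- `labelled` checks them by evaluation.
record Labelling (q : Profile) : Set where
  field
    e₁ e₂ e₃ e₄ : Fin 4
    distinct     : Unique (e₁ ∷ e₂ ∷ e₃ ∷ e₄ ∷ [])
    ℛ-profiles   : pairs-with q ≡ exceptionalᴿ e₁ e₂ e₃ e₄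
    𝒮-profiles   : transversals without ∁ q ≋ exceptionalˢ e₁ e₂ e₃ e₄

labelled : ∀ {q} e₁ e₂ e₃ e₄ →
           {True (unique? (e₁ ∷ e₂ ∷ e₃ ∷ e₄ ∷ []))} →
           {True (≡-dec profile-≟ (pairs-with q) (exceptionalᴿ e₁ e₂ e₃ e₄))} →
           {True ((transversals without ∁ q ⊆ₚ? exceptionalˢ e₁ e₂ e₃ e₄) ×-dec
                  (exceptionalˢ e₁ e₂ e₃ e₄ ⊆ₚ? transversals without ∁ q))} →
           Labelling q
labelled e₁ e₂ e₃ e₄ {distinct} {ℛ-profiles} {𝒮-profiles} =
  record { e₁ = e₁ ; e₂ = e₂ ; e₃ = e₃ ; e₄ = e₄ ; distinct = toWitness distinct
         ; ℛ-profiles = toWitness ℛ-profiles ; 𝒮-profiles = toWitness 𝒮-profiles }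

labelling : ∀ {q} → q ∈ transversals → Labelling q
labelling ∈AC = labelled (# 0) (# 1) (# 3) (# 2)
labelling ∈AD = labelled (# 0) (# 1) (# 2) (# 3)
labelling ∈BC = labelled (# 1) (# 0) (# 3) (# 2)
labelling ∈BD = labelled (# 1) (# 0) (# 2) (# 3)

module PairFrame {n c : ℕ} (1≤c : 1 ≤ c) {ℓ} {A₁ A₂ : Member n}
                 (A₁∈U : InU n c ℓ A₁) (A₂∈U : InU n c ℓ A₂) {x₁ x₂ y₁ y₂ : Block n}
                 (A₁∖A₂≡ : A₁ ∖ A₂ ≡ x₁ ∷ x₂ ∷ []) (A₂∖A₁≡ : A₂ ∖ A₁ ≡ y₁ ∷ y₂ ∷ []) where

  open import Data.List.Membership.DecPropositional (block-≟ {n}) using (_∈?_)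

  A₁-unique : Unique A₁
  A₁-unique = InU⇒Unique 1≤c A₁∈U
  A₂-unique : Unique A₂
  A₂-unique = InU⇒Unique 1≤c A₂∈U

  core : Member n
  core = filter (_∈? A₂) A₁

  letters : Member n
  letters = x₁ ∷ x₂ ∷ y₁ ∷ y₂ ∷ []

  letters≡ : letters ≡ (A₁ ∖ A₂) ++ (A₂ ∖ A₁)
  letters≡ = sym (cong₂ _++_ A₁∖A₂≡ A₂∖A₁≡)

  ∈letters⁻ : ∀ {w} → w ∈ letters → (w ∈ A₁ × w ∉ A₂) ⊎ (w ∈ A₂ × w ∉ A₁)
  ∈letters⁻ w∈ with ∈-++⁻ (A₁ ∖ A₂) (subst (_ ∈_) letters≡ w∈)
  ... | inj₁ w∈A₁∖A₂ = inj₁ (∈∖⁻ A₁ A₂ w∈A₁∖A₂)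
  ... | inj₂ w∈A₂∖A₁ = inj₂ (∈∖⁻ A₂ A₁ w∈A₂∖A₁)

  isFrame : IsFrame core letters
  isFrame = record
    { core-unique    = Unique.filter⁺ (_∈? A₂) A₁-unique
    ; letters-unique = subst Unique (sym letters≡)
        (Unique.++⁺ (∖-unique A₂ A₁-unique) (∖-unique A₁ A₂-unique)
          λ (w∈A₁∖A₂ , w∈A₂∖A₁) → proj₂ (∈∖⁻ A₁ A₂ w∈A₁∖A₂) (proj₁ (∈∖⁻ A₂ A₁ w∈A₂∖A₁)))
    ; core∩letters≡∅ = λ (w∈core , w∈letters) →
        let w∈A₁ , w∈A₂ = ∈-filter⁻ (_∈? A₂) {xs = A₁} w∈core
        in [ (λ (_ , w∉A₂) → w∉A₂ w∈A₂) , (λ (_ , w∉A₁) → w∉A₁ w∈A₁) ]′ (∈letters⁻ w∈letters)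
    }

  open Frame isFrame

  x₁-side : x₁ ∈ A₁ × x₁ ∉ A₂
  x₁-side = ∈∖⁻ A₁ A₂ (subst (x₁ ∈_) (sym A₁∖A₂≡) (here refl))
  x₂-side : x₂ ∈ A₁ × x₂ ∉ A₂
  x₂-side = ∈∖⁻ A₁ A₂ (subst (x₂ ∈_) (sym A₁∖A₂≡) (there (here refl)))
  y₁-side : y₁ ∈ A₂ × y₁ ∉ A₁
  y₁-side = ∈∖⁻ A₂ A₁ (subst (y₁ ∈_) (sym A₂∖A₁≡) (here refl))
  y₂-side : y₂ ∈ A₂ × y₂ ∉ A₁
  y₂-side = ∈∖⁻ A₂ A₁ (subst (y₂ ∈_) (sym A₂∖A₁≡) (there (here refl)))

  A₁-spanned : Spanned A₁
  A₁-spanned = (A₁-unique , A₁⊆) , λ w∈core → proj₁ (∈-filter⁻ (_∈? A₂) {xs = A₁} w∈core)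
    where
    A₁⊆ : A₁ ⊆ core ++ letters
    A₁⊆ {w} w∈A₁ with w ∈? A₂
    ... | yes w∈A₂ = ∈-++⁺ˡ (∈-filter⁺ (_∈? A₂) w∈A₁ w∈A₂)
    ... | no  w∉A₂ = ∈-++⁺ʳ core (subst (w ∈_) (sym letters≡)
                                         (∈-++⁺ˡ (∈-filter⁺ (∁? (_∈? A₂)) w∈A₁ w∉A₂)))

  A₂-spanned : Spanned A₂
  A₂-spanned = (A₂-unique , A₂⊆) , λ w∈core → proj₂ (∈-filter⁻ (_∈? A₂) {xs = A₁} w∈core)
    where
    A₂⊆ : A₂ ⊆ core ++ letters
    A₂⊆ {w} w∈A₂ with w ∈? A₁
    ... | yes w∈A₁ = ∈-++⁺ˡ (∈-filter⁺ (_∈? A₂) w∈A₁ w∈A₂)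
    ... | no  w∉A₁ = ∈-++⁺ʳ core (subst (w ∈_) (sym letters≡)
                                         (∈-++⁺ʳ (A₁ ∖ A₂) (∈-filter⁺ (∁? (_∈? A₁)) w∈A₂ w∉A₁)))

  profile-A₁ : profile A₁ ≡ AB
  profile-A₁ rewrite dec-true  (x₁ ∈? A₁) (proj₁ x₁-side) | dec-true  (x₂ ∈? A₁) (proj₁ x₂-side)
                   | dec-false (y₁ ∈? A₁) (proj₂ y₁-side) | dec-false (y₂ ∈? A₁) (proj₂ y₂-side) = refl

  profile-A₂ : profile A₂ ≡ CD
  profile-A₂ rewrite dec-false (x₁ ∈? A₂) (proj₂ x₁-side) | dec-false (x₂ ∈? A₂) (proj₂ x₂-side)
                   | dec-true  (y₁ ∈? A₂) (proj₁ y₁-side) | dec-true  (y₂ ∈? A₂) (proj₁ y₂-side) = refl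

module Analysis {n c t' : ℕ} (1≤c : 1 ≤ c) {ℛ 𝒮 : Family n}
                (ℛ∈U : FamilyIn n c (suc t' + 1) ℛ) (𝒮∈U : FamilyIn n c (suc t' + 1) 𝒮)
                (cross : CrossTIntersecting (suc t') ℛ 𝒮) (τ𝒮 : TauEq n c (suc t') 𝒮 (suc t' + 1)) where

  Conclusion : Set
  Conclusion = (suc t' ≡ 1 × Exceptional n c ℛ 𝒮) ⊎
               (length ℛ * length 𝒮 < (suc t' + 2) * (suc t' + 2) × length ℛ + length 𝒮 ≤ 8)

  t+1≡2+t' : suc t' + 1 ≡ 2 + t'
  t+1≡2+t' = cong suc (+-comm t' 1)

  member-size : ∀ {F X} → All (InU n c (suc t' + 1)) F → X ∈ F → InU n c (2 + t') X
  member-size {X = X} F⊆U X∈F = subst (λ ℓ → InU n c ℓ X) t+1≡2+t' (All.lookup F⊆U X∈F)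

  ℛ-size : ∀ {A} → A ∈ ℛ → InU n c (2 + t') A
  ℛ-size = member-size (proj₁ ℛ∈U)

  𝒮-size : ∀ {B} → B ∈ 𝒮 → InU n c (2 + t') B
  𝒮-size = member-size (proj₁ 𝒮∈U)

  ℛ-unique : ∀ {A} → A ∈ ℛ → Unique A
  ℛ-unique = InU⇒Unique 1≤c ∘ ℛ-size

  𝒮-unique : ∀ {B} → B ∈ 𝒮 → Unique B
  𝒮-unique = InU⇒Unique 1≤c ∘ 𝒮-size

  τ𝒮′ : TauEq n c (suc t') 𝒮 (2 + t')
  τ𝒮′ = subst (TauEq n c (suc t') 𝒮) t+1≡2+t' τ𝒮

  cross∈ : ∀ {A B} → A ∈ ℛ → B ∈ 𝒮 → suc t' ≤ ∣ A ∩ᵐ B ∣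
  cross∈ A∈ℛ B∈𝒮 = cross _ _ (∈⇒∈ᶠ A∈ℛ) (∈⇒∈ᶠ B∈𝒮)

  cross∈′ : ∀ {A B} → A ∈ ℛ → B ∈ 𝒮 → suc t' ≤ ∣ B ∩ᵐ A ∣
  cross∈′ A∈ℛ B∈𝒮 = subst (suc t' ≤_) (∩ᵐ-comm (ℛ-unique A∈ℛ) (𝒮-unique B∈𝒮)) (cross∈ A∈ℛ B∈𝒮)

  small-intersection : ∀ {A₁ A₂} → A₁ ∈ ℛ → A₂ ∈ ℛ → ∣ A₁ ∩ᵐ A₂ ∣ < suc t' → ∣ A₁ ∩ᵐ A₂ ∣ ≡ t'
  small-intersection A₁∈ℛ A₂∈ℛ ∣A₁∩A₂∣<t =
    let B₀ , B₀∈𝒮 = τ-nonempty τ𝒮′ in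
    ≤-antisym (≤-pred ∣A₁∩A₂∣<t) (large-∩ᵐ⇒∩ᵐ-≥ (𝒮-unique B₀∈𝒮) (proj₁ (𝒮-size B₀∈𝒮))
                                                (cross∈′ A₁∈ℛ B₀∈𝒮) (cross∈′ A₂∈ℛ B₀∈𝒮))

  ∖-pair : ∀ {A₁ A₂} → A₁ ∈ ℛ → ∣ A₁ ∩ᵐ A₂ ∣ ≡ t' → ∃₂ λ x₁ x₂ → A₁ ∖ A₂ ≡ x₁ ∷ x₂ ∷ []
  ∖-pair {A₁} {A₂} A₁∈ℛ ∣A₁∩A₂∣≡t' =
    length≡2⇒pair (length-∖ {X = A₁} {Y = A₂} (proj₁ (ℛ-size A₁∈ℛ)) ∣A₁∩A₂∣≡t')

  module _ {A₁ A₂} (A₁∈ℛ : A₁ ∈ ℛ) (A₂∈ℛ : A₂ ∈ ℛ) (∣A₁∩A₂∣≡t' : ∣ A₁ ∩ᵐ A₂ ∣ ≡ t')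
           {x₁ x₂ y₁ y₂} (A₁∖A₂≡ : A₁ ∖ A₂ ≡ x₁ ∷ x₂ ∷ []) (A₂∖A₁≡ : A₂ ∖ A₁ ≡ y₁ ∷ y₂ ∷ []) where

    open PairFrame 1≤c (ℛ-size A₁∈ℛ) (ℛ-size A₂∈ℛ) A₁∖A₂≡ A₂∖A₁≡
    open Frame isFrame
    open import Data.List.Membership.DecPropositional (block-≟ {n}) using (_∈?_)

    length-core : ∀ {X} → InU n c (2 + t') X → length X ≡ 2 + length core
    length-core X∈U = trans (proj₁ X∈U) (cong (2 +_) (sym ∣A₁∩A₂∣≡t'))

    above-core : ∀ {x} → suc t' ≤ x → suc (length core) ≤ x
    above-core = subst (λ s → suc s ≤ _) (sym ∣A₁∩A₂∣≡t')

    𝒮-members : ∀ {B} → B ∈ 𝒮 → Spanned B × profile B ∈ transversals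
    𝒮-members {B} B∈𝒮 =
      let B-spanned , meets-A₁ , meets-A₂ =
            squeeze A₁-spanned A₂-spanned (trans profile-A₂ (cong ∁ (sym profile-A₁))) (𝒮-unique B∈𝒮)
                    (length-core (𝒮-size B∈𝒮)) (above-core (cross∈′ A₁∈ℛ B∈𝒮)) (above-core (cross∈′ A₂∈ℛ B∈𝒮))
      in B-spanned , one-each⇒∈transversals (profile B)
                       (subst (λ p → ∣ profile B ∩ p ∣ˢ ≡ 1) profile-A₁ meets-A₁)
                       (subst (λ p → ∣ profile B ∩ p ∣ˢ ≡ 1) profile-A₂ meets-A₂)

    τ𝒮-core : TauEq n c (suc (length core)) 𝒮 (2 + length core)
    τ𝒮-core = subst (λ s → TauEq n c (suc s) 𝒮 (2 + s)) (sym ∣A₁∩A₂∣≡t') τ𝒮′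

    𝒮-avoids : ∀ i → ∃ λ B → B ∈ 𝒮 × letter i ∉ B
    𝒮-avoids i = [ (λ (ℓ∈A₁ , _) → avoids (ℛ-size A₁∈ℛ) (proj₂ A₁-spanned) {i} ℓ∈A₁)
                 , (λ (ℓ∈A₂ , _) → avoids (ℛ-size A₂∈ℛ) (proj₂ A₂-spanned) {i} ℓ∈A₂) ]′ (∈letters⁻ (∈-lookup i))
      where
      avoids : ∀ {ℓ A} → InU n c ℓ A → core ⊆ A → ∀ {i} → letter i ∈ A → ∃ λ B → B ∈ 𝒮 × letter i ∉ B
      avoids = letter-avoided τ𝒮-core (proj₂ ∘ proj₁ ∘ 𝒮-members)

    𝒮-profile-avoids : ∀ i → Avoids (λ p → ∃ λ B → B ∈ 𝒮 × profile B ≡ p) i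
    𝒮-profile-avoids i = let B , B∈𝒮 , ℓ∉B = 𝒮-avoids i in
      profile B , proj₂ (𝒮-members B∈𝒮) , trans (profile-bit B i) (dec-false (letter i ∈? B) ℓ∉B) ,
      B , B∈𝒮 , refl

    complementary-in-𝒮 : ∃₂ λ B₁ B₂ → B₁ ∈ 𝒮 × B₂ ∈ 𝒮 × profile B₂ ≡ ∁ (profile B₁)
    complementary-in-𝒮 =
      let p , (B₁ , B₁∈𝒮 , pB₁≡p) , (B₂ , B₂∈𝒮 , pB₂≡∁p) =
            complementary-pair (𝒮-profile-avoids (# 0)) (𝒮-profile-avoids (# 1))
                               (𝒮-profile-avoids (# 2)) (𝒮-profile-avoids (# 3))
      in B₁ , B₂ , B₁∈𝒮 , B₂∈𝒮 , trans pB₂≡∁p (cong ∁ (sym pB₁≡p))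

    ℛ-members : ∀ {A} → A ∈ ℛ → Spanned A × profile A ∈ pairs
    ℛ-members {A} A∈ℛ =
      let B₁ , B₂ , B₁∈𝒮 , B₂∈𝒮 , pB₂≡∁pB₁ = complementary-in-𝒮
          A-spanned , meets-B₁ , meets-B₂ =
            squeeze (proj₁ (𝒮-members B₁∈𝒮)) (proj₁ (𝒮-members B₂∈𝒮)) pB₂≡∁pB₁ (ℛ-unique A∈ℛ)
                    (length-core (ℛ-size A∈ℛ)) (above-core (cross∈ A∈ℛ B₁∈𝒮)) (above-core (cross∈ A∈ℛ B₂∈𝒮))
      in A-spanned , ∣p∣≡2⇒p∈pairs (profile A) (trans (∣p∣≡∣p∩q∣+∣p∩∁q∣ (profile A) (profile B₁))
                       (cong₂ _+_ meets-B₁ (subst (λ q → ∣ profile A ∩ q ∣ˢ ≡ 1) pB₂≡∁pB₁ meets-B₂)))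

    profile-cross : ∀ {A B} → A ∈ ℛ → B ∈ 𝒮 → profile B ≢ ∁ (profile A)
    profile-cross {A} {B} A∈ℛ B∈𝒮 pB≡∁pA = 1+n≰n (begin
      suc (length core)                            ≤⟨ above-core (cross∈ A∈ℛ B∈𝒮) ⟩
      ∣ A ∩ᵐ B ∣                                    ≡⟨ ∩ᵐ-spanned A-spanned (proj₂ (proj₁ (𝒮-members B∈𝒮))) ⟩
      length core + ∣ profile A ∩ profile B ∣ˢ      ≡⟨ cong (λ q → length core + ∣ profile A ∩ q ∣ˢ) pB≡∁pA ⟩
      length core + ∣ profile A ∩ ∁ (profile A) ∣ˢ  ≡⟨ cong (length core +_) (∣p∩∁p∣≡0 (profile A)) ⟩
      length core + 0                              ≡⟨ +-identityʳ _ ⟩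
      length core                                  ∎)
      where
      open ≤-Reasoning
      A-spanned : Spanned A
      A-spanned = proj₁ (ℛ-members A∈ℛ)

    distinct-profiles : ∀ {F} → (∀ {X} → X ∈ F → Spanned X) → AllPairs (λ X Y → ¬ X ≈ Y) F →
                        Unique (map profile F)
    distinct-profiles F-spanned F-distinct = AllPairs.map⁺ (AllPairs-weaken
      (λ X∈F Y∈F X≉Y pX≡pY → X≉Y (profile-injective (F-spanned X∈F) (F-spanned Y∈F) pX≡pY)) F-distinct)

    PR PS : List Profile
    PR = map profile ℛ
    PS = map profile 𝒮

    map-profile-⊆ : ∀ {F : Family n} {qs} → (∀ {X} → X ∈ F → profile X ∈ qs) → map profile F ⊆ qs
    map-profile-⊆ F→qs p∈ = let X , X∈F , p≡pX = ∈-map⁻ profile p∈ in subst (_∈ _) (sym p≡pX) (F→qs X∈F)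

    Counts : ℕ → ℕ → Set
    Counts r s = r + s ≤ 6 × (r * s < 9 ⊎ (r * s ≡ 9 × Extremal PR PS))

    profile-counts : Counts (length PR) (length PS)
    profile-counts = profile-bounds
      (distinct-profiles (proj₁ ∘ ℛ-members) (proj₂ ℛ∈U)) (distinct-profiles (proj₁ ∘ 𝒮-members) (proj₂ 𝒮∈U))
      (map-profile-⊆ (proj₂ ∘ ℛ-members)) (map-profile-⊆ (proj₂ ∘ 𝒮-members))
      (subst (_∈ PR) profile-A₁ (∈-map⁺ profile A₁∈ℛ)) (subst (_∈ PR) profile-A₂ (∈-map⁺ profile A₂∈ℛ))
      λ p∈PR q∈PS q≡∁p →
        let A , A∈ℛ , p≡pA = ∈-map⁻ profile p∈PR
            B , B∈𝒮 , q≡pB = ∈-map⁻ profile q∈PS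
        in profile-cross A∈ℛ B∈𝒮 (trans (sym q≡pB) (trans q≡∁p (cong ∁ p≡pA)))

    exceptional : t' ≡ 0 → Extremal PR PS → Exceptional n c ℛ 𝒮
    exceptional refl (q , q∈transversals , PR≋ , PS≋) =
      exceptional-by-profiles (length≡0⇒[] ∣A₁∩A₂∣≡t')
        (λ A∈ℛ → ℛ-size A∈ℛ , proj₁ (ℛ-members A∈ℛ)) (λ B∈𝒮 → 𝒮-size B∈𝒮 , proj₁ (𝒮-members B∈𝒮))
        distinct (subst (PR ≋_) ℛ-profiles PR≋) (≋-trans PS≋ 𝒮-profiles)
      where open Labelling (labelling q∈transversals)

    member-counts : Counts (length ℛ) (length 𝒮)
    member-counts = subst₂ Counts (length-map profile ℛ) (length-map profile 𝒮) profile-counts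

    conclusion : Conclusion
    conclusion = finish member-counts (t' ℕ.≟ 0)
      where
      finish : Counts (length ℛ) (length 𝒮) → Dec (t' ≡ 0) → Conclusion
      finish (sum≤6 , inj₁ product<9) _ =
        inj₂ (≤-trans product<9 (9≤[t+2]² t') , ≤-trans sum≤6 (≤ᵇ⇒≤ 6 8 _))
      finish (_ , inj₂ (_ , extremal)) (yes t'≡0) =
        inj₁ (cong suc t'≡0 , exceptional t'≡0 extremal)
      finish (sum≤6 , inj₂ (product≡9 , _)) (no t'≢0) =
        inj₂ (≤-trans (≤-reflexive (cong suc product≡9)) (10≤[t+2]² t'≢0) , ≤-trans sum≤6 (≤ᵇ⇒≤ 6 8 _))

lemma3p7 : (c k t : ℕ) → 2 ≤ c → 1 ≤ k → 1 ≤ t → t + 3 ≤ k →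
    (ℛ 𝒮 : Family (c * k)) →
    FamilyIn (c * k) c (t + 1) ℛ → FamilyIn (c * k) c (t + 1) 𝒮 →
    CrossTIntersecting t ℛ 𝒮 →
    TauEq (c * k) c t ℛ (t + 1) → TauEq (c * k) c t 𝒮 (t + 1) →
    ¬ TIntersecting t ℛ →
    (t ≡ 1 × Σ (Block (c * k)) λ e₁ → Σ (Block (c * k)) λ e₂ →
       Σ (Block (c * k)) λ e₃ → Σ (Block (c * k)) λ e₄ →
       InU (c * k) c 2 (e₁ ∷ e₂ ∷ []) × InU (c * k) c 2 (e₃ ∷ e₄ ∷ []) ×
       InU (c * k) c 2 (e₁ ∷ e₃ ∷ []) × InU (c * k) c 2 (e₂ ∷ e₄ ∷ []) ×
       InU (c * k) c 2 (e₁ ∷ e₄ ∷ []) ×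
       (ℛ ≈ᶠ ((e₁ ∷ e₂ ∷ []) ∷ (e₃ ∷ e₄ ∷ []) ∷ (e₁ ∷ e₄ ∷ []) ∷ [])) ×
       (𝒮 ≈ᶠ ((e₁ ∷ e₃ ∷ []) ∷ (e₂ ∷ e₄ ∷ []) ∷ (e₁ ∷ e₄ ∷ []) ∷ [])))
    ⊎ ((∣ ℛ ∣ᶠ * ∣ 𝒮 ∣ᶠ < (t + 2) * (t + 2)) × (∣ ℛ ∣ᶠ + ∣ 𝒮 ∣ᶠ ≤ 8))
lemma3p7 _ _ zero _ _ () _ _ _ _ _ _ _ _ _
lemma3p7 c k (suc t') 2≤c _ _ _ ℛ 𝒮 ℛ∈U 𝒮∈U cross _ τ𝒮 ¬intersecting =
  let A₁ , A₂ , A₁∈ℛ , A₂∈ℛ , ∣A₁∩A₂∣<t = non-intersecting-pair ℛ-unique ¬intersecting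
      ∣A₁∩A₂∣≡t' = small-intersection A₁∈ℛ A₂∈ℛ ∣A₁∩A₂∣<t
      ∣A₂∩A₁∣≡t' = trans (∩ᵐ-comm (ℛ-unique A₂∈ℛ) (ℛ-unique A₁∈ℛ)) ∣A₁∩A₂∣≡t'
      x₁ , x₂ , A₁∖A₂≡ = ∖-pair A₁∈ℛ ∣A₁∩A₂∣≡t'
      y₁ , y₂ , A₂∖A₁≡ = ∖-pair A₂∈ℛ ∣A₂∩A₁∣≡t'
  in conclusion A₁∈ℛ A₂∈ℛ ∣A₁∩A₂∣≡t' A₁∖A₂≡ A₂∖A₁≡
  where open Analysis (<⇒≤ 2≤c) ℛ∈U 𝒮∈U cross τ𝒮
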